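{- Let $G$ be a strongly $2$-monophonic graph not isomorphic to $P_3$, and let $x,y,z$ be three distinct vertices of $G$. Then there exist an induced $x,y$-path $P$ and an induced $y,z$-path $Q$ in $G$ such that $y$ is the only vertex belonging to both $P$ and $Q$.
   Context: All graphs are finite and simple. For a graph $G$ and $u,v\in V(G)$, the monophonic interval $J_G(u,v)$ is the set of all vertices lying on some induced $u,v$-path in $G$, with the convention $u,v\in J_G(u,v)$ and $J_G(u,u)=\{u\}$. A set $S\subseteq V(G)$ is monophonic if for every $w\in V(G)$ there exist $x,y\in S$ with $w\in J_G(x,y)$; $m(G)$ is the minimum size of a monophonic set. $G$ is $2$-monophonic if $m(G)=2$, and strongly $2$-monophonic if it is $2$-monophonic and $\{x,y\}$ is a monophonic set for every pair of non-adjacent vertices $x,y$. -}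

module Defs where

open import Data.Nat using (ℕ; zero; suc)
open import Data.Fin using (Fin; toℕ; fromℕ)
open import Data.Fin.Subset using (Subset; _∈_; ⁅_⁆; _∪_; ∣_∣)
open import Data.Bool using (Bool; true; false)
open import Data.Product using (Σ; ∃; ∃-syntax; _×_; _,_)
open import Data.Sum using (_⊎_)
open import Relation.Binary.PropositionalEquality using (_≡_; _≢_)
open import Relation.Nullary using (¬_)
open import Function.Bundles using (_↔_; Inverse)
open import Function.Definitions using (Injective)
open import Data.Nat using (_<_)

record Graph (n : ℕ) : Set where
  field
    adj    : Fin n → Fin n → Bool
    sym    : ∀ u v → adj u v ≡ adj v u
    irrefl : ∀ u → adj u u ≡ false

open Graph public

Adj : ∀ {n} → Graph n → Fin n → Fin n → Set
Adj G u v = adj G u v ≡ true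

Consecutive : ∀ {k} → Fin k → Fin k → Set
Consecutive i j = toℕ j ≡ suc (toℕ i) ⊎ toℕ i ≡ suc (toℕ j)

record InducedPath {n : ℕ} (G : Graph n) (u v : Fin n) : Set where
  field
    len   : ℕ
    vtx   : Fin (suc len) → Fin n
    start : vtx Data.Fin.zero ≡ u
    end   : vtx (fromℕ len) ≡ v
    inj   : Injective _≡_ _≡_ vtx
    chord : ∀ i j → (Adj G (vtx i) (vtx j) → Consecutive i j)
                  × (Consecutive i j → Adj G (vtx i) (vtx j))

open InducedPath public

OnPath : ∀ {n} {G : Graph n} {u v : Fin n} → Fin n → InducedPath G u v → Set
OnPath w P = ∃[ i ] vtx P i ≡ w

InJ : ∀ {n} → Graph n → Fin n → Fin n → Fin n → Set
InJ G u v w = w ≡ u ⊎ w ≡ v ⊎ (Σ (InducedPath G u v) λ P → OnPath w P)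

Monophonic : ∀ {n} → Graph n → Subset n → Set
Monophonic G S = ∀ w → ∃[ x ] ∃[ y ] (x ∈ S × y ∈ S × InJ G x y w)

TwoMonophonic : ∀ {n} → Graph n → Set
TwoMonophonic {n} G =
  (∃[ S ] (Monophonic G S × ∣ S ∣ ≡ 2))
  × (∀ (S : Subset n) → Monophonic G S → ¬ (∣ S ∣ < 2))

StronglyTwoMonophonic : ∀ {n} → Graph n → Set
StronglyTwoMonophonic {n} G =
  TwoMonophonic G
  × (∀ (x y : Fin n) → x ≢ y → ¬ Adj G x y → Monophonic G (⁅ x ⁆ ∪ ⁅ y ⁆))

Iso : ∀ {n m} → Graph n → Graph m → Set
Iso {n} {m} G H = Σ (Fin n ↔ Fin m) λ f →
  ∀ u v → adj H (Inverse.to f u) (Inverse.to f v) ≡ adj G u v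

p3adj : Fin 3 → Fin 3 → Bool
p3adj Data.Fin.zero (Data.Fin.suc Data.Fin.zero) = true
p3adj (Data.Fin.suc Data.Fin.zero) Data.Fin.zero = true
p3adj (Data.Fin.suc Data.Fin.zero) (Data.Fin.suc (Data.Fin.suc Data.Fin.zero)) = true
p3adj (Data.Fin.suc (Data.Fin.suc Data.Fin.zero)) (Data.Fin.suc Data.Fin.zero) = true
p3adj _ _ = false

P3 : Graph 3
P3 = record { adj = p3adj ; sym = s ; irrefl = r }
  where
  open Relation.Binary.PropositionalEquality using (refl)
  open Data.Fin using (zero; suc)
  s : ∀ u v → p3adj u v ≡ p3adj v u
  s zero zero = refl
  s zero (suc zero) = refl
  s zero (suc (suc zero)) = refl
  s (suc zero) zero = refl
  s (suc zero) (suc zero) = refl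
  s (suc zero) (suc (suc zero)) = refl
  s (suc (suc zero)) zero = refl
  s (suc (suc zero)) (suc zero) = refl
  s (suc (suc zero)) (suc (suc zero)) = refl
  r : ∀ u → p3adj u u ≡ false
  r zero = refl
  r (suc zero) = refl
  r (suc (suc zero)) = refl

-- If x and z are non-adjacent, y lies on an induced x,z-path and cuts it into the two required
-- paths. Otherwise x z is an edge. If y is adjacent to both, take the two edges; if y is adjacent
-- to x only, take the edge x y and an induced y,z-path avoiding x, which exists unless G ≅ P₃. If
-- y is adjacent to neither, y lies on an induced path from a neighbour q of z to x, and z joined
-- to the last vertex of that path before y adjacent to z yields the y,z-path.
module Submission where

open import Defs
open import Data.Bool using (Bool; true; false) renaming (_≟_ to _≟ᵇ_)
open import Data.Bool.Properties using (¬-not)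
open import Data.Empty using (⊥-elim)
open import Data.Fin using (Fin; toℕ; fromℕ) renaming (zero to fzero; suc to fsuc)
open import Data.Fin.Properties using (toℕ-injective; toℕ-fromℕ; toℕ-fromℕ<; toℕ≤pred[n]; any?)
  renaming (_≟_ to _≟ᶠ_)
open import Data.Fin.Subset using (⁅_⁆; _∪_) renaming (_∈_ to _∈ˢ_)
open import Data.Fin.Subset.Properties using (x∈⁅y⁆⇒x≡y; x∈p∪q⁻)
open import Data.Nat using (ℕ; zero; suc; _+_; _∸_; _≤_; _<_; z≤n; s≤s)
open import Data.Nat.DivMod using (_mod_; m%n<n; m<n⇒m%n≡m)
open import Data.Nat.Properties
  using (≤-refl; ≤-trans; ≤-antisym; <⇒≤; ≤-pred; 1+n≰n; m≤n⇒m≤1+n; m≤n⇒m<n∨m≡n;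
         +-suc; +-cancelˡ-≡; +-cancelʳ-≡; +-monoˡ-<; m≤n+m; m≤o∸n⇒m+n≤o; m∸n+n≡m; m∸n≤m;
         m∸[m∸n]≡n; n∸n≡0; ∸-cancelˡ-≡)
open import Data.Product using (Σ; ∃; _×_; _,_; proj₁; proj₂)
open import Data.Sum using (_⊎_; inj₁; inj₂; [_,_]′)
import Data.Sum
open import Function.Base using (_∘_)
open import Function.Bundles using (mk↔ₛ′)
open import Relation.Binary.PropositionalEquality using (_≡_; _≢_; refl; cong; subst; trans)
import Relation.Binary.PropositionalEquality as ≡
open import Relation.Nullary using (¬_; Dec; yes; no)
open import Relation.Nullary.Decidable using (¬?; _×-dec_)

greatest-true-≤ : (f : ℕ → Bool) → f 0 ≡ true → ∀ a →
                  ∃ λ c → c ≤ a × f c ≡ true × (∀ {i} → c < i → i ≤ a → f i ≡ false)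
greatest-true-≤ f f0 zero = 0 , z≤n , f0 , λ { (s≤s _) () }
greatest-true-≤ f f0 (suc a) with f (suc a) in fa
... | true = suc a , ≤-refl , fa , λ c< i≤ → ⊥-elim (1+n≰n (≤-trans c< i≤))
... | false with greatest-true-≤ f f0 a
...   | c , c≤a , fc , beyond = c , m≤n⇒m≤1+n c≤a , fc , beyond′
  where
  beyond′ : ∀ {i} → c < i → i ≤ suc a → f i ≡ false
  beyond′ c<i i≤ with m≤n⇒m<n∨m≡n i≤
  ... | inj₁ i<1+a = beyond c<i (≤-pred i<1+a)
  ... | inj₂ refl = fa

∸-suc : ∀ L i → i < L → L ∸ i ≡ suc (L ∸ suc i)
∸-suc (suc L) zero _ = refl
∸-suc (suc L) (suc i) (s≤s i<L) = ∸-suc L i i<L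

∸-consecutive : ∀ {i j L} → i ≤ L → j ≤ L → L ∸ j ≡ suc (L ∸ i) → i ≡ suc j
∸-consecutive {i} {j} {L} i≤L j≤L e = ≡.sym (+-cancelˡ-≡ (L ∸ i) _ _ (begin
  L ∸ i + suc j    ≡⟨ +-suc (L ∸ i) j ⟩
  suc (L ∸ i) + j  ≡⟨ cong (_+ j) (≡.sym e) ⟩
  L ∸ j + j        ≡⟨ m∸n+n≡m j≤L ⟩
  L                ≡⟨ ≡.sym (m∸n+n≡m i≤L) ⟩
  L ∸ i + i        ∎))
  where open ≡.≡-Reasoning

toℕ-mod : ∀ {k L} → k ≤ L → toℕ (k mod suc L) ≡ k
toℕ-mod {k} {L} k≤L = trans (toℕ-fromℕ< (m%n<n k (suc L))) (m<n⇒m%n≡m (s≤s k≤L))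

mod-toℕ : ∀ {L} (i : Fin (suc L)) → toℕ i mod suc L ≡ i
mod-toℕ i = toℕ-injective (toℕ-mod (toℕ≤pred[n] i))

module _ {n : ℕ} (G : Graph n) where

  Adj-sym : ∀ {u v} → Adj G u v → Adj G v u
  Adj-sym {u} {v} e = trans (Graph.sym G v u) e

  Adj-irrefl : ∀ {u} → ¬ Adj G u u
  Adj-irrefl {u} e with trans (≡.sym (irrefl G u)) e
  ... | ()

  Adj⇒≢ : ∀ {u v} → Adj G u v → u ≢ v
  Adj⇒≢ e refl = Adj-irrefl e

  Adj? : ∀ u v → Dec (Adj G u v)
  Adj? u v = adj G u v ≟ᵇ true

  -- An induced path indexed by ℕ rather than by Fin, so that segments and reversal need no
  -- Fin arithmetic; the values of at beyond last are irrelevant.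
  record Path (u v : Fin n) : Set where
    field
      last      : ℕ
      at        : ℕ → Fin n
      at-first  : at 0 ≡ u
      at-last   : at last ≡ v
      injective : ∀ {i j} → i ≤ last → j ≤ last → at i ≡ at j → i ≡ j
      chordless : ∀ {i j} → i ≤ last → j ≤ last → Adj G (at i) (at j) → j ≡ suc i ⊎ i ≡ suc j
      linked    : ∀ {i} → i < last → Adj G (at i) (at (suc i))

  open Path

  _∈ₚ_ : ∀ {u v} → Fin n → Path u v → Set
  w ∈ₚ p = ∃ λ i → i ≤ last p × at p i ≡ w

  InRange : ∀ {u v} → Path u v → ℕ → ℕ → Fin n → Set
  InRange p c e w = ∃ λ k → c ≤ k × k ≤ e × at p k ≡ w

  castPath : ∀ {u v u′ v′} → u ≡ u′ → v ≡ v′ → Path u v → Path u′ v′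
  castPath eu ev p = record
    { last = last p ; at = at p ; at-first = trans (at-first p) eu ; at-last = trans (at-last p) ev
    ; injective = injective p ; chordless = chordless p ; linked = linked p }

  at≡last⇒last : ∀ {u v i} (p : Path u v) → i ≤ last p → at p i ≡ v → i ≡ last p
  at≡last⇒last p i≤ e = injective p i≤ ≤-refl (trans e (≡.sym (at-last p)))

  ∈-loop : ∀ {a w} (p : Path a a) → w ∈ₚ p → w ≡ a
  ∈-loop p (zero , _ , e) = trans (≡.sym e) (at-first p)
  ∈-loop p (suc k , 1+k≤last , _)
    with subst (suc k ≤_) (≡.sym (at≡last⇒last p z≤n (at-first p))) 1+k≤last
  ... | ()

  segment : ∀ {u v} (p : Path u v) (c e : ℕ) → c ≤ e → e ≤ last p → Path (at p c) (at p e)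
  segment p c e c≤e e≤last = record
    { last = e ∸ c ; at = λ i → at p (i + c)
    ; at-first = refl
    ; at-last = cong (at p) (m∸n+n≡m c≤e)
    ; injective = λ i≤ j≤ eq → +-cancelʳ-≡ c _ _ (injective p (bound i≤) (bound j≤) eq)
    ; chordless = λ i≤ j≤ a → Data.Sum.map (+-cancelʳ-≡ c _ _) (+-cancelʳ-≡ c _ _)
                                 (chordless p (bound i≤) (bound j≤) a)
    ; linked = λ i< → linked p (bound i<) }
    where
    bound : ∀ {i} → i ≤ e ∸ c → i + c ≤ last p
    bound {i} i≤ = ≤-trans (m≤o∸n⇒m+n≤o i c≤e i≤) e≤last

  ∈-segment : ∀ {u v w} (p : Path u v) c e (c≤e : c ≤ e) (e≤last : e ≤ last p) →
              w ∈ₚ segment p c e c≤e e≤last → InRange p c e w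
  ∈-segment p c e c≤e e≤last (i , i≤ , eq) = i + c , m≤n+m c i , m≤o∸n⇒m+n≤o i c≤e i≤ , eq

  segments-meet : ∀ {u v w} (p : Path u v) {c a} → a ≤ last p →
                  InRange p c a w → InRange p a (last p) w → w ≡ at p a
  segments-meet p a≤last (k , _ , k≤a , ek) (k′ , a≤k′ , k′≤last , ek′) =
    trans (≡.sym ek) (cong (at p) (≤-antisym k≤a (subst (_ ≤_) (≡.sym k≡k′) a≤k′)))
    where
    k≡k′ = injective p (≤-trans k≤a a≤last) k′≤last (trans ek (≡.sym ek′))

  reverse : ∀ {u v} → Path u v → Path v u
  reverse p = record
    { last = L ; at = λ i → at p (L ∸ i)
    ; at-first = at-last p
    ; at-last = trans (cong (at p) (n∸n≡0 L)) (at-first p)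
    ; injective = λ {i} {j} i≤ j≤ eq →
        ∸-cancelˡ-≡ i≤ j≤ (injective p (m∸n≤m L i) (m∸n≤m L j) eq)
    ; chordless = λ {i} {j} i≤ j≤ a → flip i≤ j≤ (chordless p (m∸n≤m L i) (m∸n≤m L j) a)
    ; linked = λ {i} i< → subst (λ t → Adj G (at p t) (at p (L ∸ suc i))) (≡.sym (∸-suc L i i<))
                            (Adj-sym (linked p (subst (_≤ L) (∸-suc L i i<) (m∸n≤m L i)))) }
    where
    L = last p
    flip : ∀ {i j} → i ≤ L → j ≤ L → L ∸ j ≡ suc (L ∸ i) ⊎ L ∸ i ≡ suc (L ∸ j) →
           j ≡ suc i ⊎ i ≡ suc j
    flip i≤ j≤ (inj₁ x) = inj₂ (∸-consecutive i≤ j≤ x)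
    flip i≤ j≤ (inj₂ x) = inj₁ (∸-consecutive j≤ i≤ x)

  ∈-reverse : ∀ {u v w} (p : Path u v) → w ∈ₚ reverse p → w ∈ₚ p
  ∈-reverse p (i , _ , eq) = last p ∸ i , m∸n≤m (last p) i , eq

  ∈-reverse⁺ : ∀ {u v w} (p : Path u v) → w ∈ₚ p → w ∈ₚ reverse p
  ∈-reverse⁺ p (i , i≤ , eq) = last p ∸ i , m∸n≤m (last p) i , trans (cong (at p) (m∸[m∸n]≡n i≤)) eq

  single : (u : Fin n) → Path u u
  single u = record
    { last = 0 ; at = λ _ → u ; at-first = refl ; at-last = refl
    ; injective = λ { z≤n z≤n _ → refl } ; chordless = λ _ _ a → ⊥-elim (Adj-irrefl a)
    ; linked = λ () }

  AdjacentOnlyToFirst : ∀ {u v} → Fin n → Path u v → Set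
  AdjacentOnlyToFirst w p = ∀ {i} → 0 < i → i ≤ last p → ¬ Adj G w (at p i)

  prepend : ∀ {u v} (w : Fin n) (p : Path u v) → Adj G w u → AdjacentOnlyToFirst w p → ¬ w ∈ₚ p →
            Path w v
  prepend w p wu far fresh = record
    { last = suc (last p) ; at = at′ ; at-first = refl ; at-last = at-last p
    ; injective = inj′ ; chordless = chordless′ ; linked = linked′ }
    where
    at′ : ℕ → Fin n
    at′ zero = w
    at′ (suc i) = at p i
    inj′ : ∀ {i j} → i ≤ suc (last p) → j ≤ suc (last p) → at′ i ≡ at′ j → i ≡ j
    inj′ {zero} {zero} _ _ _ = refl
    inj′ {zero} {suc j} _ j≤ e = ⊥-elim (fresh (j , ≤-pred j≤ , ≡.sym e))
    inj′ {suc i} {zero} i≤ _ e = ⊥-elim (fresh (i , ≤-pred i≤ , e))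
    inj′ {suc i} {suc j} i≤ j≤ e = cong suc (injective p (≤-pred i≤) (≤-pred j≤) e)
    chordless′ : ∀ {i j} → i ≤ suc (last p) → j ≤ suc (last p) → Adj G (at′ i) (at′ j) →
                 j ≡ suc i ⊎ i ≡ suc j
    chordless′ {zero} {zero} _ _ a = ⊥-elim (Adj-irrefl a)
    chordless′ {zero} {suc zero} _ _ _ = inj₁ refl
    chordless′ {zero} {suc (suc j)} _ j≤ a = ⊥-elim (far (s≤s z≤n) (≤-pred j≤) a)
    chordless′ {suc zero} {zero} _ _ _ = inj₂ refl
    chordless′ {suc (suc i)} {zero} i≤ _ a = ⊥-elim (far (s≤s z≤n) (≤-pred i≤) (Adj-sym a))
    chordless′ {suc i} {suc j} i≤ j≤ a with chordless p (≤-pred i≤) (≤-pred j≤) a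
    ... | inj₁ x = inj₁ (cong suc x)
    ... | inj₂ x = inj₂ (cong suc x)
    linked′ : ∀ {i} → i < suc (last p) → Adj G (at′ i) (at′ (suc i))
    linked′ {zero} _ = subst (Adj G w) (≡.sym (at-first p)) wu
    linked′ {suc i} i< = linked p (≤-pred i<)

  ∈-prepend : ∀ {u v w x} (p : Path u v) (wu : Adj G w u) (far : AdjacentOnlyToFirst w p)
              (fresh : ¬ w ∈ₚ p) →
              x ∈ₚ prepend w p wu far fresh → x ≡ w ⊎ x ∈ₚ p
  ∈-prepend p wu far fresh (zero , _ , eq) = inj₁ (≡.sym eq)
  ∈-prepend p wu far fresh (suc i , i≤ , eq) = inj₂ (i , ≤-pred i≤ , eq)

  edge : ∀ {a b} → Adj G a b → Path a b
  edge {a} {b} ab =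
    prepend a (single b) ab (λ { (s≤s _) () }) λ (_ , _ , b≡a) → Adj⇒≢ ab (≡.sym b≡a)

  ∈-edge : ∀ {a b w} (ab : Adj G a b) → w ∈ₚ edge ab → w ≡ a ⊎ w ≡ b
  ∈-edge ab (zero , _ , eq) = inj₁ (≡.sym eq)
  ∈-edge ab (suc _ , _ , eq) = inj₂ (≡.sym eq)

  toInducedPath : ∀ {u v} → Path u v → InducedPath G u v
  toInducedPath p = record
    { len = last p ; vtx = λ i → at p (toℕ i) ; start = at-first p
    ; end = trans (cong (at p) (toℕ-fromℕ (last p))) (at-last p)
    ; inj = λ {i} {j} e → toℕ-injective (injective p (toℕ≤pred[n] i) (toℕ≤pred[n] j) e)
    ; chord = λ i j → chordless p (toℕ≤pred[n] i) (toℕ≤pred[n] j) , consecutive⇒Adj i j }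
    where
    consecutive⇒Adj : ∀ i j → Consecutive i j → Adj G (at p (toℕ i)) (at p (toℕ j))
    consecutive⇒Adj i j (inj₁ e) = subst (λ t → Adj G (at p (toℕ i)) (at p t)) (≡.sym e)
                                     (linked p (subst (_≤ last p) e (toℕ≤pred[n] j)))
    consecutive⇒Adj i j (inj₂ e) = Adj-sym (subst (λ t → Adj G (at p (toℕ j)) (at p t)) (≡.sym e)
                                     (linked p (subst (_≤ last p) e (toℕ≤pred[n] i))))

  -- Indices beyond len P are reduced mod (len P + 1) only to make at total.
  fromInducedPath : ∀ {u v} → InducedPath G u v → Path u v
  fromInducedPath P = record
    { last = L ; at = λ k → vtx P (k mod suc L)
    ; at-first = trans (cong (vtx P) (mod-toℕ fzero)) (start P)
    ; at-last = trans (cong (λ k → vtx P (k mod suc L)) (≡.sym (toℕ-fromℕ L)))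
                      (trans (cong (vtx P) (mod-toℕ (fromℕ L))) (end P))
    ; injective = λ i≤ j≤ e → trans (≡.sym (toℕ-mod i≤)) (trans (cong toℕ (inj P e)) (toℕ-mod j≤))
    ; chordless = λ i≤ j≤ a → Data.Sum.map (unmod j≤ i≤) (unmod i≤ j≤) (proj₁ (chord P _ _) a)
    ; linked = λ i< → proj₂ (chord P _ _)
                         (inj₁ (trans (toℕ-mod i<) (cong suc (≡.sym (toℕ-mod (<⇒≤ i<)))))) }
    where
    L = len P
    unmod : ∀ {i j} → i ≤ L → j ≤ L → toℕ (i mod suc L) ≡ suc (toℕ (j mod suc L)) → i ≡ suc j
    unmod i≤ j≤ e = trans (≡.sym (toℕ-mod i≤)) (trans e (cong suc (toℕ-mod j≤)))

  ∈-fromInducedPath : ∀ {u v w} (P : InducedPath G u v) → OnPath w P → w ∈ₚ fromInducedPath P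
  ∈-fromInducedPath P (i , e) = toℕ i , toℕ≤pred[n] i , trans (cong (vtx P) (mod-toℕ i)) e

  ∈-pair : ∀ {a b x : Fin n} → x ∈ˢ (⁅ a ⁆ ∪ ⁅ b ⁆) → x ≡ a ⊎ x ≡ b
  ∈-pair {a} {b} x∈ = Data.Sum.map (x∈⁅y⁆⇒x≡y a) (x∈⁅y⁆⇒x≡y b) (x∈p∪q⁻ ⁅ a ⁆ ⁅ b ⁆ x∈)

  monophonic-pair⇒path : ∀ {a b w} → Monophonic G (⁅ a ⁆ ∪ ⁅ b ⁆) → w ≢ a → w ≢ b →
                         Σ (Path a b) (w ∈ₚ_)
  monophonic-pair⇒path {a} {b} {w} M w≢a w≢b with M w
  ... | s , t , s∈ , t∈ , w∈J = through (∈-pair s∈) (∈-pair t∈) w∈J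
    where
    not-end : ∀ {s} → s ≡ a ⊎ s ≡ b → w ≢ s
    not-end (inj₁ refl) = w≢a
    not-end (inj₂ refl) = w≢b
    through : ∀ {s t} → s ≡ a ⊎ s ≡ b → t ≡ a ⊎ t ≡ b → InJ G s t w → Σ (Path a b) (w ∈ₚ_)
    through s∈ _ (inj₁ w≡s) = ⊥-elim (not-end s∈ w≡s)
    through _ t∈ (inj₂ (inj₁ w≡t)) = ⊥-elim (not-end t∈ w≡t)
    through (inj₁ refl) (inj₁ refl) (inj₂ (inj₂ (P , w∈P))) =
      ⊥-elim (w≢a (∈-loop (fromInducedPath P) (∈-fromInducedPath P w∈P)))
    through (inj₁ refl) (inj₂ refl) (inj₂ (inj₂ (P , w∈P))) =
      fromInducedPath P , ∈-fromInducedPath P w∈P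
    through (inj₂ refl) (inj₁ refl) (inj₂ (inj₂ (P , w∈P))) =
      reverse (fromInducedPath P) , ∈-reverse⁺ (fromInducedPath P) (∈-fromInducedPath P w∈P)
    through (inj₂ refl) (inj₂ refl) (inj₂ (inj₂ (P , w∈P))) =
      ⊥-elim (w≢b (∈-loop (fromInducedPath P) (∈-fromInducedPath P w∈P)))

  common-neighbour⇒middle : ∀ {u v m} (p : Path u v) → Adj G m u → Adj G m v → m ∈ₚ p →
                            at p 1 ≡ m × last p ≡ 2
  common-neighbour⇒middle {m = m} p mu mv (i , i≤ , eim) = trans (cong (at p) (≡.sym i≡1)) eim , last≡2
    where
    m-adj : ∀ {t} → Adj G m t → Adj G (at p i) t
    m-adj = subst (λ s → Adj G s _) (≡.sym eim)
    i≡1 : i ≡ 1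
    i≡1 with chordless p i≤ z≤n (m-adj (subst (Adj G m) (≡.sym (at-first p)) mu))
    ... | inj₁ ()
    ... | inj₂ e = e
    last≡2 : last p ≡ 2
    last≡2 with chordless p i≤ ≤-refl (m-adj (subst (Adj G m) (≡.sym (at-last p)) mv))
    ... | inj₁ e = trans e (cong suc i≡1)
    ... | inj₂ e = ⊥-elim (1+n≰n (subst (_≤ last p) e i≤))

  common-neighbour-on-path : ∀ {u v m w} (p : Path u v) → Adj G m u → Adj G m v → m ∈ₚ p →
                             w ∈ₚ p → w ≡ u ⊎ w ≡ m ⊎ w ≡ v
  common-neighbour-on-path p mu mv m∈p (zero , _ , ek) = inj₁ (trans (≡.sym ek) (at-first p))
  common-neighbour-on-path p mu mv m∈p (suc zero , _ , ek) =
    inj₂ (inj₁ (trans (≡.sym ek) (proj₁ (common-neighbour⇒middle p mu mv m∈p))))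
  common-neighbour-on-path p mu mv m∈p (suc (suc k) , k≤ , ek) =
    inj₂ (inj₂ (trans (≡.sym ek) (trans (cong (at p) k≡last) (at-last p))))
    where
    last≡2 = proj₂ (common-neighbour⇒middle p mu mv m∈p)
    k≡last : suc (suc k) ≡ last p
    k≡last = ≤-antisym k≤ (subst (_≤ suc (suc k)) (≡.sym last≡2) (s≤s (s≤s z≤n)))

  predecessor : ∀ {u v w} (p : Path u v) → w ∈ₚ p → w ≢ u → w ≢ v →
                Σ (Fin n) λ q → Adj G q w × q ≢ v × ¬ Adj G q v
  predecessor p (zero , _ , e) w≢u _ = ⊥-elim (w≢u (trans (≡.sym e) (at-first p)))
  predecessor p (suc k , k< , e) _ w≢v = at p k , subst (Adj G (at p k)) e (linked p k<) , q≢v , ¬qv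
    where
    q≢v : at p k ≢ _
    q≢v q≡v = 1+n≰n (subst (suc k ≤_) (≡.sym (at≡last⇒last p (<⇒≤ k<) q≡v)) k<)
    ¬qv : ¬ Adj G (at p k) _
    ¬qv qv with chordless p (<⇒≤ k<) ≤-refl (subst (Adj G (at p k)) (≡.sym (at-last p)) qv)
    ... | inj₁ last≡1+k = w≢v (trans (≡.sym e) (trans (cong (at p) (≡.sym last≡1+k)) (at-last p)))
    ... | inj₂ k≡1+last = 1+n≰n (subst (_≤ last p) k≡1+last (<⇒≤ k<))

  -- Cut p at the last vertex up to index a that is adjacent to z.
  attach : ∀ {s t z} (p : Path s t) → Adj G z s → ¬ z ∈ₚ p → ∀ {a} → a ≤ last p →
           Σ (Path z (at p a)) λ q → ∀ {w} → w ∈ₚ q → w ≡ z ⊎ InRange p 0 a w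
  attach {z = z} p zs z∉p {a} a≤last
    with greatest-true-≤ (λ i → adj G z (at p i)) (subst (Adj G z) (≡.sym (at-first p)) zs) a
  ... | c , c≤a , zc , beyond = prepend z tail zc far fresh , ∈q
    where
    tail = segment p c a c≤a a≤last
    far : AdjacentOnlyToFirst z tail
    far {i} 0<i i≤ zi with trans (≡.sym zi) (beyond (+-monoˡ-< c 0<i) (m≤o∸n⇒m+n≤o i c≤a i≤))
    ... | ()
    fresh : ¬ z ∈ₚ tail
    fresh z∈ with ∈-segment p c a c≤a a≤last z∈
    ... | k , _ , k≤a , e = z∉p (k , ≤-trans k≤a a≤last , e)
    ∈q : ∀ {w} → w ∈ₚ prepend z tail zc far fresh → w ≡ z ⊎ InRange p 0 a w
    ∈q w∈ with ∈-prepend tail zc far fresh w∈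
    ... | inj₁ w≡z = inj₁ w≡z
    ... | inj₂ w∈tail with ∈-segment p c a c≤a a≤last w∈tail
    ...   | k , _ , k≤a , e = inj₂ (k , z≤n , k≤a , e)

  record Wedge (x y z : Fin n) : Set where
    field
      left  : Path x y
      right : Path y z
      meet  : ∀ {w} → w ∈ₚ left → w ∈ₚ right → w ≡ y

  Wedge-flip : ∀ {x y z} → Wedge x y z → Wedge z y x
  Wedge-flip W = record
    { left = reverse right ; right = reverse left
    ; meet = λ w∈r w∈l → meet (∈-reverse left w∈l) (∈-reverse right w∈r) }
    where open Wedge W

  Wedge-split : ∀ {x z a} (p : Path x z) → a ≤ last p → Wedge x (at p a) z
  Wedge-split {a = a} p a≤last = record
    { left = castPath (at-first p) refl (segment p 0 a z≤n a≤last)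
    ; right = castPath refl (at-last p) (segment p a (last p) a≤last ≤-refl)
    ; meet = λ w∈l w∈r → segments-meet p a≤last (∈-segment p 0 a z≤n a≤last w∈l)
                                              (∈-segment p a (last p) a≤last ≤-refl w∈r) }

  Wedge-edges : ∀ {x y z} → Adj G y x → Adj G y z → x ≢ z → Wedge x y z
  Wedge-edges {y = y} yx yz x≢z = record { left = edge (Adj-sym yx) ; right = edge yz ; meet = meet′ }
    where
    meet′ : ∀ {w} → w ∈ₚ edge (Adj-sym yx) → w ∈ₚ edge yz → w ≡ y
    meet′ w∈l w∈r with ∈-edge (Adj-sym yx) w∈l | ∈-edge yz w∈r
    ... | inj₂ w≡y | _ = w≡y
    ... | _ | inj₁ w≡y = w≡y
    ... | inj₁ w≡x | inj₂ w≡z = ⊥-elim (x≢z (trans (≡.sym w≡x) w≡z))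

  Wedge-edge-path : ∀ {x y z} (xy : Adj G x y) (q : Path y z) → ¬ x ∈ₚ q → Wedge x y z
  Wedge-edge-path {y = y} xy q x∉q = record { left = edge xy ; right = q ; meet = meet′ }
    where
    meet′ : ∀ {w} → w ∈ₚ edge xy → w ∈ₚ q → w ≡ y
    meet′ w∈l w∈q with ∈-edge xy w∈l
    ... | inj₁ refl = ⊥-elim (x∉q w∈q)
    ... | inj₂ w≡y = w≡y

  Wedge-attach : ∀ {q x z a} (T : Path q x) → a ≤ last T → Adj G z q → ¬ z ∈ₚ T →
                 Wedge x (at T a) z
  Wedge-attach {a = a} T a≤last zq z∉T = record
    { left = castPath (at-last T) refl (reverse after)
    ; right = reverse (proj₁ attached)
    ; meet = meet′ }
    where
    after = segment T a (last T) a≤last ≤-refl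
    attached = attach T zq z∉T a≤last
    meet′ : ∀ {w} → w ∈ₚ reverse after → w ∈ₚ reverse (proj₁ attached) → w ≡ at T a
    meet′ w∈l w∈r with ∈-segment T a (last T) a≤last ≤-refl (∈-reverse after w∈l)
                     | proj₂ attached (∈-reverse (proj₁ attached) w∈r)
    ... | (k , _ , k≤last , e) | inj₁ refl = ⊥-elim (z∉T (k , k≤last , e))
    ... | w∈after | inj₂ w∈before = segments-meet T a≤last w∈before w∈after

  Iso-P3 : ∀ {a b c} → a ≢ b → a ≢ c → b ≢ c → Adj G a b → Adj G a c → ¬ Adj G b c →
           (∀ w → w ≡ a ⊎ w ≡ b ⊎ w ≡ c) → Iso G P3
  Iso-P3 {a} {b} {c} a≢b a≢c b≢c ab ac ¬bc cover = mk↔ₛ′ to from to∘from from∘to , adj-to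
    where
    to : Fin n → Fin 3
    to w with w ≟ᶠ b | w ≟ᶠ a
    ... | yes _ | _ = fzero
    ... | no _ | yes _ = fsuc fzero
    ... | no _ | no _ = fsuc (fsuc fzero)

    from : Fin 3 → Fin n
    from fzero = b
    from (fsuc fzero) = a
    from (fsuc (fsuc fzero)) = c

    to-b : to b ≡ fzero
    to-b with b ≟ᶠ b
    ... | yes _ = refl
    ... | no b≢b = ⊥-elim (b≢b refl)

    to-a : to a ≡ fsuc fzero
    to-a with a ≟ᶠ b | a ≟ᶠ a
    ... | yes a≡b | _ = ⊥-elim (a≢b a≡b)
    ... | no _ | yes _ = refl
    ... | no _ | no a≢a = ⊥-elim (a≢a refl)

    to-c : to c ≡ fsuc (fsuc fzero)
    to-c with c ≟ᶠ b | c ≟ᶠ a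
    ... | yes c≡b | _ = ⊥-elim (b≢c (≡.sym c≡b))
    ... | no _ | yes c≡a = ⊥-elim (a≢c (≡.sym c≡a))
    ... | no _ | no _ = refl

    to∘from : ∀ k → to (from k) ≡ k
    to∘from fzero = to-b
    to∘from (fsuc fzero) = to-a
    to∘from (fsuc (fsuc fzero)) = to-c

    from∘to : ∀ w → from (to w) ≡ w
    from∘to w with cover w
    ... | inj₁ refl = cong from to-a
    ... | inj₂ (inj₁ refl) = cong from to-b
    ... | inj₂ (inj₂ refl) = cong from to-c

    ¬Adj⇒false : ∀ {u v} → ¬ Adj G u v → false ≡ adj G u v
    ¬Adj⇒false ¬uv = ≡.sym (¬-not ¬uv)

    adj-to : ∀ u v → adj P3 (to u) (to v) ≡ adj G u v
    adj-to u v with cover u | cover v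
    ... | inj₁ refl | inj₁ refl rewrite to-a = ≡.sym (irrefl G _)
    ... | inj₁ refl | inj₂ (inj₁ refl) rewrite to-a | to-b = ≡.sym ab
    ... | inj₁ refl | inj₂ (inj₂ refl) rewrite to-a | to-c = ≡.sym ac
    ... | inj₂ (inj₁ refl) | inj₁ refl rewrite to-a | to-b = ≡.sym (Adj-sym ab)
    ... | inj₂ (inj₁ refl) | inj₂ (inj₁ refl) rewrite to-b = ≡.sym (irrefl G _)
    ... | inj₂ (inj₁ refl) | inj₂ (inj₂ refl) rewrite to-b | to-c = ¬Adj⇒false ¬bc
    ... | inj₂ (inj₂ refl) | inj₁ refl rewrite to-a | to-c = ≡.sym (Adj-sym ac)
    ... | inj₂ (inj₂ refl) | inj₂ (inj₁ refl) rewrite to-b | to-c = ¬Adj⇒false (¬bc ∘ Adj-sym)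
    ... | inj₂ (inj₂ refl) | inj₂ (inj₂ refl) rewrite to-c = ≡.sym (irrefl G _)

  module _ (strong : ∀ x y → x ≢ y → ¬ Adj G x y → Monophonic G (⁅ x ⁆ ∪ ⁅ y ⁆))
           (not-P3 : ¬ Iso G P3) where

    path-through : ∀ {a b w} → a ≢ b → ¬ Adj G a b → w ≢ a → w ≢ b → Σ (Path a b) (w ∈ₚ_)
    path-through a≢b ¬ab = monophonic-pair⇒path (strong _ _ a≢b ¬ab)

    -- Without a fourth vertex G would be the path b a c.
    path-avoiding-common-neighbour : ∀ {a b c} → a ≢ b → a ≢ c → b ≢ c →
                                     Adj G a b → Adj G a c → ¬ Adj G b c →
                                     Σ (Path b c) λ p → ¬ a ∈ₚ p
    path-avoiding-common-neighbour {a} {b} {c} a≢b a≢c b≢c ab ac ¬bc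
      with any? (λ w → ¬? (w ≟ᶠ a) ×-dec ¬? (w ≟ᶠ b) ×-dec ¬? (w ≟ᶠ c))
    ... | yes (w , w≢a , w≢b , w≢c) with path-through b≢c ¬bc w≢b w≢c
    ...   | p , w∈p =
      p , λ a∈p → [ w≢b , [ w≢a , w≢c ]′ ]′ (common-neighbour-on-path p ab ac a∈p w∈p)
    path-avoiding-common-neighbour {a} {b} {c} a≢b a≢c b≢c ab ac ¬bc
      | no no-fourth = ⊥-elim (not-P3 (Iso-P3 a≢b a≢c b≢c ab ac ¬bc cover))
      where
      cover : ∀ w → w ≡ a ⊎ w ≡ b ⊎ w ≡ c
      cover w with w ≟ᶠ a | w ≟ᶠ b | w ≟ᶠ c
      ... | yes w≡a | _ | _ = inj₁ w≡a
      ... | no _ | yes w≡b | _ = inj₂ (inj₁ w≡b)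
      ... | no _ | no _ | yes w≡c = inj₂ (inj₂ w≡c)
      ... | no w≢a | no w≢b | no w≢c = ⊥-elim (no-fourth (w , w≢a , w≢b , w≢c))

    wedge-nonadjacent-ends : ∀ {x y z} → x ≢ y → y ≢ z → x ≢ z → ¬ Adj G x z → Wedge x y z
    wedge-nonadjacent-ends x≢y y≢z x≢z ¬xz
      with path-through x≢z ¬xz (x≢y ∘ ≡.sym) y≢z
    ... | p , (a , a≤last , at-a) = subst (λ t → Wedge _ t _) at-a (Wedge-split p a≤last)

    wedge-adjacent-centre : ∀ {x y z} → x ≢ y → y ≢ z → x ≢ z →
                            Adj G x y → Adj G x z → ¬ Adj G y z → Wedge x y z
    wedge-adjacent-centre x≢y y≢z x≢z xy xz ¬yz
      with path-avoiding-common-neighbour x≢y x≢z y≢z xy xz ¬yz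
    ... | q , x∉q = Wedge-edge-path xy q x∉q

    -- z lies on an induced y,x-path; its predecessor q there starts an induced q,x-path T
    -- through y, and z avoids T because it is a common neighbour of the ends q and x.
    wedge-isolated-centre : ∀ {x y z} → x ≢ y → y ≢ z → x ≢ z →
                            ¬ Adj G y x → ¬ Adj G y z → Adj G x z → Wedge x y z
    wedge-isolated-centre {x} {y} {z} x≢y y≢z x≢z ¬yx ¬yz xz
      with path-through (x≢y ∘ ≡.sym) ¬yx (y≢z ∘ ≡.sym) (x≢z ∘ ≡.sym)
    ... | r , z∈r with predecessor r z∈r (y≢z ∘ ≡.sym) (x≢z ∘ ≡.sym)
    ... | q , qz , q≢x , ¬qx with path-through q≢x ¬qx y≢q (x≢y ∘ ≡.sym)
      where
      y≢q : y ≢ q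
      y≢q refl = ¬yz qz
    ... | T , y∈T@(a , a≤last , at-a) =
      subst (λ t → Wedge x t z) at-a (Wedge-attach T a≤last (Adj-sym qz) z∉T)
      where
      z∉T : ¬ z ∈ₚ T
      z∉T z∈T with common-neighbour-on-path T (Adj-sym qz) (Adj-sym xz) z∈T y∈T
      ... | inj₁ refl = ¬yz qz
      ... | inj₂ (inj₁ y≡z) = y≢z y≡z
      ... | inj₂ (inj₂ y≡x) = x≢y (≡.sym y≡x)

    wedge : ∀ {x y z} → x ≢ y → y ≢ z → x ≢ z → Wedge x y z
    wedge {x} {y} {z} x≢y y≢z x≢z with Adj? x z | Adj? y x | Adj? y z
    ... | no ¬xz | _ | _ = wedge-nonadjacent-ends x≢y y≢z x≢z ¬xz
    ... | yes _ | yes yx | yes yz = Wedge-edges yx yz x≢z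
    ... | yes xz | yes yx | no ¬yz = wedge-adjacent-centre x≢y y≢z x≢z (Adj-sym yx) xz ¬yz
    ... | yes xz | no ¬yx | yes yz =
      Wedge-flip (wedge-adjacent-centre (y≢z ∘ ≡.sym) (x≢y ∘ ≡.sym) (x≢z ∘ ≡.sym)
                                        (Adj-sym yz) (Adj-sym xz) ¬yx)
    ... | yes xz | no ¬yx | no ¬yz = wedge-isolated-centre x≢y y≢z x≢z ¬yx ¬yz xz

lemma3p9 : ∀ {n : ℕ} (G : Graph n) → StronglyTwoMonophonic G → ¬ Iso G P3 →
           (x y z : Fin n) → x ≢ y → y ≢ z → x ≢ z →
           Σ (InducedPath G x y) λ P → Σ (InducedPath G y z) λ Q →
             ∀ i j → vtx P i ≡ vtx Q j → vtx P i ≡ y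
lemma3p9 G (_ , strong) not-P3 x y z x≢y y≢z x≢z =
  toInducedPath G left , toInducedPath G right ,
  λ i j e → meet (toℕ i , toℕ≤pred[n] i , refl) (toℕ j , toℕ≤pred[n] j , ≡.sym e)
  where open Wedge (wedge G strong not-P3 x≢y y≢z x≢z)
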